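{- Let $\Delta$ be a flag $(d-1)$-dimensional simplicial complex, and let $\sigma=\tau_1\sqcup\tau_2$ be a facet of $\Delta$, where $\tau_1$ is an $i$-face and $\tau_2$ is a $(d-i-2)$-face. If $V(\mathrm{lk}_\Delta\tau_1)\cup V(\mathrm{lk}_\Delta\tau_2)=V(\Delta)$, then $\Delta\subseteq\mathrm{lk}_\Delta\tau_1*\mathrm{lk}_\Delta\tau_2$. Moreover, if $\Delta$ is a flag normal $(d-1)$-pseudomanifold, then $V(\mathrm{lk}_\Delta\tau_1)\cup V(\mathrm{lk}_\Delta\tau_2)=V(\Delta)$ if and only if $\Delta=\mathrm{lk}_\Delta\tau_1*\mathrm{lk}_\Delta\tau_2$.
   Context: A simplicial complex is flag if every minimal non-face has exactly two elements. For a face $\tau$, $\mathrm{lk}_\Delta\tau=\{\rho-\tau:\tau\subseteq\rho\in\Delta\}$, and $V(\cdot)$ denotes vertex sets. The join $\Gamma_1*\Gamma_2$ of complexes on disjoint vertex sets is $\{\alpha\cup\beta:\alpha\in\Gamma_1,\beta\in\Gamma_2\}$. A $(d-1)$-dimensional complex is a weak $(d-1)$-pseudomanifold if it is pure and every $(d-2)$-face lies in exactly two facets; it is a normal $(d-1)$-pseudomanifold if moreover it is connected and the link of every face of dimension $\leq d-3$ is connected. -}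

module Defs where

open import Level using (0ℓ)
open import Data.Nat using (ℕ; _+_; _≤_)
open import Data.Fin using (Fin)
open import Data.Fin.Subset using (Subset; ⁅_⁆; _∈_; _∉_; _⊆_; _⊂_; _∪_; _─_; ∣_∣)
open import Data.Product using (Σ; ∃; ∃-syntax; _×_; _,_)
open import Data.Sum using (_⊎_)
open import Relation.Nullary using (¬_; Dec)
open import Relation.Binary.PropositionalEquality using (_≡_; _≢_)

-- Its vertex set V(Δ) may be a proper part of Fin n.
record Complex (n : ℕ) : Set₁ where
  field
    face      : Subset n → Set
    face?     : (S : Subset n) → Dec (face S)
    downClosed : ∀ {S T} → face T → S ⊆ T → face S
open Complex public

-- A "family of subsets" (links, joins are defined as such families).
Family : ℕ → Set₁
Family n = Subset n → Set

V : ∀ {n} → Family n → Fin n → Set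
V Γ v = Γ ⁅ v ⁆

IsFacet : ∀ {n} → Complex n → Subset n → Set
IsFacet Δ F = face Δ F × (∀ G → face Δ G → F ⊆ G → G ≡ F)

-- Δ is (d-1)-dimensional: maximal face cardinality is d.
HasDim : ∀ {n} → Complex n → ℕ → Set
HasDim Δ d = (∃[ F ] (face Δ F × ∣ F ∣ ≡ d)) × (∀ F → face Δ F → ∣ F ∣ ≤ d)

IsMinimalNonFace : ∀ {n} → Complex n → Subset n → Set
IsMinimalNonFace Δ S =
  (∀ {v} → v ∈ S → V (face Δ) v) × ¬ face Δ S × (∀ T → T ⊂ S → face Δ T)

IsFlag : ∀ {n} → Complex n → Set
IsFlag Δ = ∀ S → IsMinimalNonFace Δ S → ∣ S ∣ ≡ 2

lk : ∀ {n} → Complex n → Subset n → Family n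
lk Δ τ S = ∃[ ρ ] (τ ⊆ ρ × face Δ ρ × S ≡ ρ ─ τ)

_✶_ : ∀ {n} → Family n → Family n → Family n
(Γ₁ ✶ Γ₂) S = ∃[ α ] ∃[ β ] (Γ₁ α × Γ₂ β × S ≡ α ∪ β)

_⊑_ : ∀ {n} → Family n → Family n → Set
Γ₁ ⊑ Γ₂ = ∀ S → Γ₁ S → Γ₂ S

_≐_ : ∀ {n} → Family n → Family n → Set
Γ₁ ≐ Γ₂ = Γ₁ ⊑ Γ₂ × Γ₂ ⊑ Γ₁

VertexUnionIs : ∀ {n} → Family n → Family n → Family n → Set
VertexUnionIs Γ₁ Γ₂ Δ = ∀ v → (V Γ₁ v ⊎ V Γ₂ v → V Δ v) × (V Δ v → V Γ₁ v ⊎ V Γ₂ v)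

data Path {n} (Γ : Family n) : Fin n → Fin n → Set where
  here : ∀ {u} → Path Γ u u
  step : ∀ {u w v} → Γ (⁅ u ⁆ ∪ ⁅ w ⁆) → Path Γ w v → Path Γ u v

Connected : ∀ {n} → Family n → Set
Connected Γ = ∀ u v → V Γ u → V Γ v → Path Γ u v

IsPure : ∀ {n} → Complex n → ℕ → Set
IsPure Δ d = ∀ F → IsFacet Δ F → ∣ F ∣ ≡ d

InExactlyTwoFacets : ∀ {n} → Complex n → Subset n → Set
InExactlyTwoFacets Δ ρ =
  ∃[ F₁ ] ∃[ F₂ ] (F₁ ≢ F₂ × IsFacet Δ F₁ × IsFacet Δ F₂ × ρ ⊆ F₁ × ρ ⊆ F₂
    × (∀ G → IsFacet Δ G → ρ ⊆ G → G ≡ F₁ ⊎ G ≡ F₂))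

IsWeakPseudomanifold : ∀ {n} → Complex n → ℕ → Set
IsWeakPseudomanifold Δ d =
  HasDim Δ d × IsPure Δ d
  × (∀ ρ → face Δ ρ → ∣ ρ ∣ + 1 ≡ d → InExactlyTwoFacets Δ ρ)

-- Normal (d-1)-pseudomanifold: faces of dimension ≤ d-3 are those with
-- ∣ τ ∣ + 2 ≤ d.
IsNormalPseudomanifold : ∀ {n} → Complex n → ℕ → Set
IsNormalPseudomanifold Δ d =
  IsWeakPseudomanifold Δ d × Connected (face Δ)
  × (∀ τ → face Δ τ → ∣ τ ∣ + 2 ≤ d → Connected (lk Δ τ))

module Submission where

-- Throughout, σ = τ₁ ⊔ τ₂ is a facet of a flag complex Δ of dimension d - 1,
-- and a vertex v is a *link vertex* of τ when v ∉ τ and τ ∪ {v} ∈ Δ.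
--
-- * Flag complexes are determined by their edges (flag closure), so a set of
--   link vertices of τ lying in a face is a face of lk τ.  If every vertex of
--   Δ is a link vertex of τ₁ or of τ₂, a face F therefore splits as
--   (F ∩ link vertices of τ₁) ∪ (F ∩ link vertices of τ₂) ∈ lk τ₁ * lk τ₂.
--   Since σ is a facet, no vertex is a link vertex of both τ₁ and τ₂.
-- * Conversely Δ = lk τ₁ * lk τ₂ clearly forces the vertex condition.
-- * For the reverse inclusion in a normal pseudomanifold, fix a facet H ⊇ τ₁
--   and A = H ─ τ₁.  For facets G ⊇ τ₂ put Φ G = A ∪ (G ─ τ₂); Φ σ ⊆ H is a
--   face, and a face Φ G₀ propagates to Φ G₁ across any ridge ⊇ τ₂ of G₀ and
--   G₁, because the ridge Φ ρ lies in exactly two facets of Δ.  The facets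
--   containing τ₂ are connected through such ridges (normality), so every
--   Φ G is a face, and α ∪ β ⊆ Φ G for α ∈ lk τ₁, β ∈ lk τ₂ and G ⊇ τ₂ ∪ β.

open import Defs
open import Data.Nat using (ℕ; zero; suc; _+_; _≤_; _<_; z≤n; s≤s)
open import Data.Nat.Properties
  using (+-suc; +-comm; +-identityʳ; +-cancelˡ-≡; +-cancelˡ-≤; +-monoʳ-≤; m<m+n;
         ≤-trans; ≤-reflexive; <-≤-trans; n≮n)
open import Data.Bool using (true; false)
open import Data.Fin using (Fin)
open import Data.Fin.Properties using (any?)
open import Data.Fin.Subset using (Subset; ⊥; ⁅_⁆; _∈_; _∉_; _⊆_; _⊂_; _⊃_; _∩_; _∪_; _─_; ∣_∣; Empty)
open import Data.Fin.Subset.Properties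
  using (_∈?_; x∈p∪q⁻; x∈p∪q⁺; p⊆p∪q; q⊆p∪q; x∈p∧x∉q⇒x∈p─q; p─q⊆p; ⊆-antisym; ⊆-refl; ⊆-trans;
         x∈⁅x⁆; x∈⁅y⁆⇒x≡y; p⊆q⇒∣p∣≤∣q∣; p⊂q⇒p⊆q; ∣⁅x⁆∣≡1; ∣⊥∣≡0; drop-∷-⊆;
         x∈p∩q⁺; x∈p∩q⁻; p∩q⊆p)
open import Data.Fin.Subset.Induction using (⊂-wellFounded; ⊃-wellFounded; Acc; acc)
open import Data.Vec using ([]; _∷_; here; there; tabulate)
open import Data.Vec.Properties using ([]=⇒lookup; lookup⇒[]=; lookup∘tabulate)
open import Data.Product using (_×_; ∃-syntax; _,_; proj₁; proj₂)
open import Data.Sum using (_⊎_; inj₁; inj₂; [_,_])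
open import Data.Empty using (⊥-elim)
open import Relation.Nullary using (¬_; Dec; yes; no; ¬?; _×-dec_; does)
open import Relation.Nullary.Decidable using (dec-true)
open import Relation.Binary.PropositionalEquality
  using (_≡_; _≢_; refl; sym; trans; cong; cong₂; subst; module ≡-Reasoning)

-- Finite sets of vertices

Disjoint : ∀ {n} → Subset n → Subset n → Set
Disjoint p q = ∀ {x} → x ∈ p → x ∉ q

∈─-∉ : ∀ {n} {x : Fin n} (p q : Subset n) → x ∈ p ─ q → x ∉ q
∈─-∉ (_ ∷ p) (true ∷ q) () here
∈─-∉ (_ ∷ p) (_ ∷ q) (there h) (there h') = ∈─-∉ p q h h'

∪-lub : ∀ {n} {p q r : Subset n} → p ⊆ r → q ⊆ r → p ∪ q ⊆ r
∪-lub {p = p} {q} p⊆r q⊆r h with x∈p∪q⁻ p q h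
... | inj₁ x∈p = p⊆r x∈p
... | inj₂ x∈q = q⊆r x∈q

⁅⁆⊆ : ∀ {n} {x : Fin n} {p : Subset n} → x ∈ p → ⁅ x ⁆ ⊆ p
⁅⁆⊆ {x = x} x∈p h with x∈⁅y⁆⇒x≡y x h
... | refl = x∈p

pair⊆ : ∀ {n} {u w : Fin n} {p : Subset n} → u ∈ p → w ∈ p → ⁅ u ⁆ ∪ ⁅ w ⁆ ⊆ p
pair⊆ u∈p w∈p = ∪-lub (⁅⁆⊆ u∈p) (⁅⁆⊆ w∈p)

─-mono : ∀ {n} {p q : Subset n} (τ : Subset n) → p ⊆ q → p ─ τ ⊆ q ─ τ
─-mono {p = p} τ p⊆q x∈p─τ = x∈p∧x∉q⇒x∈p─q (p⊆q (p─q⊆p p τ x∈p─τ)) (∈─-∉ p τ x∈p─τ)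

∪─-split : ∀ {n} (τ X : Subset n) → τ ⊆ X → X ≡ τ ∪ (X ─ τ)
∪─-split τ X τ⊆X = ⊆-antisym into (∪-lub τ⊆X (p─q⊆p X τ))
  where
  into : X ⊆ τ ∪ (X ─ τ)
  into {x} x∈X with x ∈? τ
  ... | yes x∈τ = x∈p∪q⁺ (inj₁ x∈τ)
  ... | no x∉τ = x∈p∪q⁺ (inj₂ (x∈p∧x∉q⇒x∈p─q x∈X x∉τ))

∪─-cancel : ∀ {n} (τ β : Subset n) → Disjoint β τ → (τ ∪ β) ─ τ ≡ β
∪─-cancel τ β β#τ = ⊆-antisym out (λ x∈β → x∈p∧x∉q⇒x∈p─q (q⊆p∪q τ β x∈β) (β#τ x∈β))
  where
  out : (τ ∪ β) ─ τ ⊆ β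
  out h with x∈p∪q⁻ τ β (p─q⊆p _ τ h)
  ... | inj₁ x∈τ = ⊥-elim (∈─-∉ (τ ∪ β) τ h x∈τ)
  ... | inj₂ x∈β = x∈β

∣∪∣ : ∀ {n} (p q : Subset n) → Disjoint p q → ∣ p ∪ q ∣ ≡ ∣ p ∣ + ∣ q ∣
∣∪∣ [] [] _ = refl
∣∪∣ (true ∷ p) (true ∷ q) p#q = ⊥-elim (p#q here here)
∣∪∣ (true ∷ p) (false ∷ q) p#q = cong suc (∣∪∣ p q (λ a b → p#q (there a) (there b)))
∣∪∣ (false ∷ p) (true ∷ q) p#q =
  trans (cong suc (∣∪∣ p q (λ a b → p#q (there a) (there b)))) (sym (+-suc ∣ p ∣ ∣ q ∣))
∣∪∣ (false ∷ p) (false ∷ q) p#q = ∣∪∣ p q (λ a b → p#q (there a) (there b))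

∣split∣ : ∀ {n} (τ X : Subset n) → τ ⊆ X → ∣ τ ∣ + ∣ X ─ τ ∣ ≡ ∣ X ∣
∣split∣ τ X τ⊆X =
  trans (sym (∣∪∣ τ (X ─ τ) (λ x∈τ x∈X─τ → ∈─-∉ X τ x∈X─τ x∈τ))) (cong ∣_∣ (sym (∪─-split τ X τ⊆X)))

∣∪⁅⁆∣ : ∀ {n} (p : Subset n) {v : Fin n} → v ∉ p → ∣ p ∪ ⁅ v ⁆ ∣ ≡ suc ∣ p ∣
∣∪⁅⁆∣ p {v} v∉p = begin
  ∣ p ∪ ⁅ v ⁆ ∣   ≡⟨ ∣∪∣ p ⁅ v ⁆ (λ x∈p x∈v → v∉p (subst (_∈ p) (x∈⁅y⁆⇒x≡y v x∈v) x∈p)) ⟩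
  ∣ p ∣ + ∣ ⁅ v ⁆ ∣ ≡⟨ cong (∣ p ∣ +_) (∣⁅x⁆∣≡1 v) ⟩
  ∣ p ∣ + 1       ≡⟨ +-comm ∣ p ∣ 1 ⟩
  suc ∣ p ∣       ∎
  where open ≡-Reasoning

⊆-∣∣-≡ : ∀ {n} (p q : Subset n) → p ⊆ q → ∣ q ∣ ≤ ∣ p ∣ → p ≡ q
⊆-∣∣-≡ [] [] _ _ = refl
⊆-∣∣-≡ (true ∷ p) (true ∷ q) p⊆q (s≤s le) = cong (true ∷_) (⊆-∣∣-≡ p q (drop-∷-⊆ p⊆q) le)
⊆-∣∣-≡ (true ∷ p) (false ∷ q) p⊆q _ with p⊆q here
... | ()
⊆-∣∣-≡ (false ∷ p) (true ∷ q) p⊆q le =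
  ⊥-elim (n≮n ∣ q ∣ (<-≤-trans le (p⊆q⇒∣p∣≤∣q∣ (drop-∷-⊆ p⊆q))))
⊆-∣∣-≡ (false ∷ p) (false ∷ q) p⊆q le = cong (false ∷_) (⊆-∣∣-≡ p q (drop-∷-⊆ p⊆q) le)

larger⇒outside : ∀ {n} (τ F : Subset n) → ∣ τ ∣ < ∣ F ∣ → ∃[ u ] (u ∈ F × u ∉ τ)
larger⇒outside τ F τ<F with any? (λ u → u ∈? F ×-dec ¬? (u ∈? τ))
... | yes found = found
... | no none = ⊥-elim (n≮n ∣ τ ∣ (<-≤-trans τ<F (p⊆q⇒∣p∣≤∣q∣ F⊆τ)))
  where
  F⊆τ : F ⊆ τ
  F⊆τ {x} x∈F with x ∈? τ
  ... | yes x∈τ = x∈τ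
  ... | no x∉τ = ⊥-elim (none (x , x∈F , x∉τ))

∣∣≡2⇒pair : ∀ {n} (S : Subset n) → ∣ S ∣ ≡ 2 → ∃[ u ] ∃[ w ] (u ∈ S × w ∈ S × S ≡ ⁅ u ⁆ ∪ ⁅ w ⁆)
∣∣≡2⇒pair {n} S ∣S∣≡2 with larger⇒outside ⊥ S (subst (_< ∣ S ∣) (sym (∣⊥∣≡0 n)) 0<∣S∣)
  where
  0<∣S∣ : 0 < ∣ S ∣
  0<∣S∣ = subst (0 <_) (sym ∣S∣≡2) (s≤s z≤n)
... | u , u∈S , _ with larger⇒outside ⁅ u ⁆ S (subst (_< ∣ S ∣) (sym (∣⁅x⁆∣≡1 u)) 1<∣S∣)
  where
  1<∣S∣ : 1 < ∣ S ∣
  1<∣S∣ = subst (1 <_) (sym ∣S∣≡2) (s≤s (s≤s z≤n))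
... | w , w∈S , w∉u = u , w , u∈S , w∈S , sym (⊆-∣∣-≡ _ S (pair⊆ u∈S w∈S) S≤pair)
  where
  S≤pair : ∣ S ∣ ≤ ∣ ⁅ u ⁆ ∪ ⁅ w ⁆ ∣
  S≤pair = ≤-reflexive (trans ∣S∣≡2 (sym (trans (∣∪⁅⁆∣ ⁅ u ⁆ w∉u) (cong suc (∣⁅x⁆∣≡1 u)))))

select : ∀ {n} {P : Fin n → Set} → (∀ x → Dec (P x)) → Subset n
select P? = tabulate (λ x → does (P? x))

select⁺ : ∀ {n} {P : Fin n → Set} (P? : ∀ x → Dec (P x)) {x} → P x → x ∈ select P?
select⁺ P? {x} px = lookup⇒[]= x _ (trans (lookup∘tabulate _ x) (dec-true (P? x) px))

select⁻ : ∀ {n} {P : Fin n → Set} (P? : ∀ x → Dec (P x)) {x} → x ∈ select P? → P x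
select⁻ P? {x} h with P? x | trans (sym (lookup∘tabulate (λ y → does (P? y)) x)) ([]=⇒lookup h)
... | yes px | _ = px
... | no _ | ()

-- Faces, links and facets of an arbitrary complex

module Faces {n} (Δ : Complex n) where

  dc : ∀ {S T} → face Δ T → S ⊆ T → face Δ S
  dc = downClosed Δ

  LinkVertex : Subset n → Fin n → Set
  LinkVertex τ v = v ∉ τ × face Δ (τ ∪ ⁅ v ⁆)

  linkVertex? : ∀ τ v → Dec (LinkVertex τ v)
  linkVertex? τ v = ¬? (v ∈? τ) ×-dec face? Δ (τ ∪ ⁅ v ⁆)

  lk⇒ : ∀ {τ α} → lk Δ τ α → Disjoint α τ × face Δ (τ ∪ α)
  lk⇒ {τ} (ρ , τ⊆ρ , fρ , refl) = ∈─-∉ ρ τ , dc fρ (∪-lub τ⊆ρ (p─q⊆p ρ τ))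

  ⇒lk : ∀ {τ α} → Disjoint α τ → face Δ (τ ∪ α) → lk Δ τ α
  ⇒lk {τ} {α} α#τ f = τ ∪ α , p⊆p∪q α , f , sym (∪─-cancel τ α α#τ)

  outside⇒linkVertex : ∀ {τ G x} → face Δ G → τ ⊆ G → x ∈ G ─ τ → LinkVertex τ x
  outside⇒linkVertex {τ} {G} fG τ⊆G x∈G─τ =
    ∈─-∉ G τ x∈G─τ , dc fG (∪-lub τ⊆G (⁅⁆⊆ (p─q⊆p G τ x∈G─τ)))

  linkFace-⊆-─ : ∀ {τ γ K} → lk Δ τ γ → τ ∪ γ ⊆ K → γ ⊆ K ─ τ
  linkFace-⊆-─ {τ} {γ} lkγ τγ⊆K x∈γ = x∈p∧x∉q⇒x∈p─q (τγ⊆K (q⊆p∪q τ γ x∈γ)) (proj₁ (lk⇒ lkγ) x∈γ)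

  linkFace⇒linkVertex : ∀ {τ α x} → lk Δ τ α → x ∈ α → LinkVertex τ x
  linkFace⇒linkVertex {τ} {α} lkα x∈α =
    outside⇒linkVertex (proj₂ (lk⇒ lkα)) (p⊆p∪q α) (linkFace-⊆-─ lkα ⊆-refl x∈α)

  V⇒linkVertex : ∀ {τ v} → V (lk Δ τ) v → LinkVertex τ v
  V⇒linkVertex {v = v} h = linkFace⇒linkVertex h (x∈⁅x⁆ v)

  linkVertex⇒V : ∀ {τ v} → LinkVertex τ v → V (lk Δ τ) v
  linkVertex⇒V {τ} {v} (v∉τ , f) = ⇒lk (λ x∈v → subst (_∉ τ) (sym (x∈⁅y⁆⇒x≡y v x∈v)) v∉τ) f

  linkVertex⇒vertex : ∀ {τ v} → LinkVertex τ v → V (face Δ) v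
  linkVertex⇒vertex {τ} (_ , f) = dc f (q⊆p∪q τ _)

  Covered : Subset n → Subset n → Set
  Covered τ₁ τ₂ = ∀ v → V (face Δ) v → LinkVertex τ₁ v ⊎ LinkVertex τ₂ v

  vertexUnion⇒covered : ∀ {τ₁ τ₂} → VertexUnionIs (lk Δ τ₁) (lk Δ τ₂) (face Δ) → Covered τ₁ τ₂
  vertexUnion⇒covered vertexUnion v vertex with proj₂ (vertexUnion v) vertex
  ... | inj₁ inLink₁ = inj₁ (V⇒linkVertex inLink₁)
  ... | inj₂ inLink₂ = inj₂ (V⇒linkVertex inLink₂)

  joinCovers : ∀ {τ₁ τ₂} → face Δ ⊑ (lk Δ τ₁ ✶ lk Δ τ₂) → VertexUnionIs (lk Δ τ₁) (lk Δ τ₂) (face Δ)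
  joinCovers {τ₁} {τ₂} Δ⊑join v = inVertices , inLinks
    where
    inVertices : V (lk Δ τ₁) v ⊎ V (lk Δ τ₂) v → V (face Δ) v
    inVertices (inj₁ inLink₁) = linkVertex⇒vertex (V⇒linkVertex inLink₁)
    inVertices (inj₂ inLink₂) = linkVertex⇒vertex (V⇒linkVertex inLink₂)
    inLinks : V (face Δ) v → V (lk Δ τ₁) v ⊎ V (lk Δ τ₂) v
    inLinks vertex with Δ⊑join ⁅ v ⁆ vertex
    ... | α , β , lkα , lkβ , v≡α∪β with x∈p∪q⁻ α β (subst (v ∈_) v≡α∪β (x∈⁅x⁆ v))
    ...   | inj₁ v∈α = inj₁ (linkVertex⇒V (linkFace⇒linkVertex lkα v∈α))
    ...   | inj₂ v∈β = inj₂ (linkVertex⇒V (linkFace⇒linkVertex lkβ v∈β))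

  extendToFacet : ∀ S → face Δ S → ∃[ F ] (IsFacet Δ F × S ⊆ F)
  extendToFacet S = grow S (⊃-wellFounded S)
    where
    grow : ∀ S → Acc _⊃_ S → face Δ S → ∃[ F ] (IsFacet Δ F × S ⊆ F)
    grow S (acc larger) fS with any? (linkVertex? S)
    ... | yes (v , v∉S , fSv) with grow (S ∪ ⁅ v ⁆) (larger S⊂Sv) fSv
      where
      S⊂Sv : S ⊂ S ∪ ⁅ v ⁆
      S⊂Sv = p⊆p∪q ⁅ v ⁆ , v , q⊆p∪q S ⁅ v ⁆ (x∈⁅x⁆ v) , v∉S
    ...   | F , facetF , Sv⊆F = F , facetF , λ x∈S → Sv⊆F (p⊆p∪q ⁅ v ⁆ x∈S)
    grow S _ fS | no maximal = S , (fS , λ G fG S⊆G → ⊆-antisym (G⊆S G fG S⊆G) S⊆G) , ⊆-refl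
      where
      G⊆S : ∀ G → face Δ G → S ⊆ G → G ⊆ S
      G⊆S G fG S⊆G {x} x∈G with x ∈? S
      ... | yes x∈S = x∈S
      ... | no x∉S = ⊥-elim (maximal (x , x∉S , dc fG (∪-lub S⊆G (⁅⁆⊆ x∈G))))

  fullSize⇒facet : ∀ {d} → (∀ F → face Δ F → ∣ F ∣ ≤ d) → ∀ {K} → face Δ K → ∣ K ∣ ≡ d → IsFacet Δ K
  fullSize⇒facet dimBound {K} fK ∣K∣≡d =
    fK , λ G fG K⊆G → sym (⊆-∣∣-≡ K G K⊆G (≤-trans (dimBound G fG) (≤-reflexive (sym ∣K∣≡d))))

-- Flag complexes

module Flag {n} (Δ : Complex n) (flag : IsFlag Δ) where
  open Faces Δ

  PairwiseFaces : Subset n → Set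
  PairwiseFaces S = ∀ {u w} → u ∈ S → w ∈ S → ∃[ X ] (face Δ X × u ∈ X × w ∈ X)

  -- A flag complex is determined by its edges: pairwise faces form a face.
  -- (A minimal non-face among the subsets of S would be a pair, i.e. an edge.)
  flagClosure : ∀ S → PairwiseFaces S → face Δ S
  flagClosure S = close S (⊂-wellFounded S)
    where
    close : ∀ S → Acc _⊂_ S → PairwiseFaces S → face Δ S
    close S (acc smaller) pairs with face? Δ S
    ... | yes fS = fS
    ... | no nonFace with ∣∣≡2⇒pair S (flag S (vertices , nonFace , proper))
      where
      vertices : ∀ {v} → v ∈ S → V (face Δ) v
      vertices v∈S with pairs v∈S v∈S
      ... | X , fX , v∈X , _ = dc fX (⁅⁆⊆ v∈X)
      proper : ∀ T → T ⊂ S → face Δ T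
      proper T T⊂S = close T (smaller T⊂S) (λ u∈T w∈T → pairs (p⊂q⇒p⊆q T⊂S u∈T) (p⊂q⇒p⊆q T⊂S w∈T))
    ...   | u , w , u∈S , w∈S , S≡uw with pairs u∈S w∈S
    ...   | X , fX , u∈X , w∈X = ⊥-elim (nonFace (subst (face Δ) (sym S≡uw) (dc fX (pair⊆ u∈X w∈X))))

  flagUnion : ∀ {A B} → face Δ A → face Δ B
            → (∀ {a b} → a ∈ A → b ∈ B → ∃[ X ] (face Δ X × a ∈ X × b ∈ X)) → face Δ (A ∪ B)
  flagUnion {A} {B} fA fB across = flagClosure (A ∪ B) pairs
    where
    pairs : PairwiseFaces (A ∪ B)
    pairs {u} {w} u∈ w∈ with x∈p∪q⁻ A B u∈ | x∈p∪q⁻ A B w∈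
    ... | inj₁ u∈A | inj₁ w∈A = A , fA , u∈A , w∈A
    ... | inj₂ u∈B | inj₂ w∈B = B , fB , u∈B , w∈B
    ... | inj₁ u∈A | inj₂ w∈B = across u∈A w∈B
    ... | inj₂ u∈B | inj₁ w∈A with across w∈A u∈B
    ...   | X , fX , w∈X , u∈X = X , fX , u∈X , w∈X

  linkVertices⇒linkFace : ∀ {τ γ F} → face Δ τ → face Δ F → γ ⊆ F
                        → (∀ {x} → x ∈ γ → LinkVertex τ x) → lk Δ τ γ
  linkVertices⇒linkFace {τ} {γ} {F} fτ fF γ⊆F linkγ =
    ⇒lk (λ x∈γ → proj₁ (linkγ x∈γ)) (flagUnion fτ (dc fF γ⊆F) edge)
    where
    edge : ∀ {a b} → a ∈ τ → b ∈ γ → ∃[ X ] (face Δ X × a ∈ X × b ∈ X)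
    edge {b = b} a∈τ b∈γ = τ ∪ ⁅ b ⁆ , proj₂ (linkγ b∈γ) , p⊆p∪q ⁅ b ⁆ a∈τ , q⊆p∪q τ ⁅ b ⁆ (x∈⁅x⁆ b)

  linkPart : Subset n → Subset n → Subset n
  linkPart τ F = F ∩ select (linkVertex? τ)

  linkPart-vertex : ∀ {τ F x} → x ∈ linkPart τ F → LinkVertex τ x
  linkPart-vertex {τ} {F} h = select⁻ (linkVertex? τ) (proj₂ (x∈p∩q⁻ F _ h))

  linkPart-∈ : ∀ {τ F x} → x ∈ F → LinkVertex τ x → x ∈ linkPart τ F
  linkPart-∈ {τ} x∈F link = x∈p∩q⁺ (x∈F , select⁺ (linkVertex? τ) link)

  linkPart∈lk : ∀ {τ F} → face Δ τ → face Δ F → lk Δ τ (linkPart τ F)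
  linkPart∈lk {τ} {F} fτ fF = linkVertices⇒linkFace fτ fF (p∩q⊆p F _) linkPart-vertex

  face≡linkParts : ∀ {τ₁ τ₂ F} → Covered τ₁ τ₂ → face Δ F → F ≡ linkPart τ₁ F ∪ linkPart τ₂ F
  face≡linkParts {τ₁} {τ₂} {F} covered fF = ⊆-antisym split (∪-lub (p∩q⊆p F _) (p∩q⊆p F _))
    where
    split : F ⊆ linkPart τ₁ F ∪ linkPart τ₂ F
    split {x} x∈F with covered x (dc fF (⁅⁆⊆ x∈F))
    ... | inj₁ link₁ = x∈p∪q⁺ (inj₁ (linkPart-∈ x∈F link₁))
    ... | inj₂ link₂ = x∈p∪q⁺ (inj₂ (linkPart-∈ x∈F link₂))

  faceInJoin : ∀ {τ₁ τ₂} → face Δ τ₁ → face Δ τ₂ → Covered τ₁ τ₂ → face Δ ⊑ (lk Δ τ₁ ✶ lk Δ τ₂)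
  faceInJoin {τ₁} {τ₂} f₁ f₂ covered F fF =
    linkPart τ₁ F , linkPart τ₂ F , linkPart∈lk f₁ fF , linkPart∈lk f₂ fF , face≡linkParts covered fF

  -- If τ₁ ⊔ τ₂ is a facet, no vertex is a link vertex of both τ₁ and τ₂:
  -- otherwise adding it to the facet would give a larger face.
  linkVertices-disjoint : ∀ {τ₁ τ₂ x} → IsFacet Δ (τ₁ ∪ τ₂)
                        → ¬ (LinkVertex τ₁ x × LinkVertex τ₂ x)
  linkVertices-disjoint {τ₁} {τ₂} {x} (fσ , maximal) ((x∉τ₁ , fτ₁x) , (x∉τ₂ , fτ₂x))
    with x∈p∪q⁻ τ₁ τ₂ x∈σ
    where
    σ : Subset n
    σ = τ₁ ∪ τ₂
    edge : ∀ {a b} → a ∈ σ → b ∈ ⁅ x ⁆ → ∃[ X ] (face Δ X × a ∈ X × b ∈ X)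
    edge a∈σ b∈x with x∈p∪q⁻ τ₁ τ₂ a∈σ
    ... | inj₁ a∈τ₁ = τ₁ ∪ ⁅ x ⁆ , fτ₁x , p⊆p∪q ⁅ x ⁆ a∈τ₁ , q⊆p∪q τ₁ ⁅ x ⁆ b∈x
    ... | inj₂ a∈τ₂ = τ₂ ∪ ⁅ x ⁆ , fτ₂x , p⊆p∪q ⁅ x ⁆ a∈τ₂ , q⊆p∪q τ₂ ⁅ x ⁆ b∈x
    σ∪x≡σ : σ ∪ ⁅ x ⁆ ≡ σ
    σ∪x≡σ = maximal (σ ∪ ⁅ x ⁆) (flagUnion fσ (dc fτ₁x (q⊆p∪q τ₁ ⁅ x ⁆)) edge) (p⊆p∪q ⁅ x ⁆)
    x∈σ : x ∈ σ
    x∈σ = subst (x ∈_) σ∪x≡σ (q⊆p∪q σ ⁅ x ⁆ (x∈⁅x⁆ x))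
  ... | inj₁ x∈τ₁ = x∉τ₁ x∈τ₁
  ... | inj₂ x∈τ₂ = x∉τ₂ x∈τ₂

-- Ridges and strong connectivity of stars in normal pseudomanifolds

module Ridges {n} (Δ : Complex n) (d : ℕ) where
  open Faces Δ

  data RidgePath (τ : Subset n) : Subset n → Subset n → Set where
    stay  : ∀ {F} → RidgePath τ F F
    cross : ∀ {F G K} (ρ : Subset n) → τ ⊆ ρ → ∣ ρ ∣ + 1 ≡ d → ρ ⊆ F → ρ ⊆ G
          → IsFacet Δ G → RidgePath τ G K → RidgePath τ F K

  _++_ : ∀ {τ F G K} → RidgePath τ F G → RidgePath τ G K → RidgePath τ F K
  stay ++ q = q
  cross ρ τ⊆ρ ridge ρ⊆F ρ⊆G facetG p ++ q = cross ρ τ⊆ρ ridge ρ⊆F ρ⊆G facetG (p ++ q)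

  shrink : ∀ {τ τ′ F G} → τ ⊆ τ′ → RidgePath τ′ F G → RidgePath τ F G
  shrink τ⊆τ′ stay = stay
  shrink τ⊆τ′ (cross ρ τ′⊆ρ ridge ρ⊆F ρ⊆G facetG p) =
    cross ρ (λ x∈τ → τ′⊆ρ (τ⊆τ′ x∈τ)) ridge ρ⊆F ρ⊆G facetG (shrink τ⊆τ′ p)

  otherFacet : ∀ {ρ K} → InExactlyTwoFacets Δ ρ → IsFacet Δ K → ρ ⊆ K
             → ∃[ L ] (IsFacet Δ L × ρ ⊆ L × L ≢ K)
  otherFacet (F₁ , F₂ , F₁≢F₂ , facet₁ , facet₂ , ρ⊆F₁ , ρ⊆F₂ , onlyTwo) facetK ρ⊆K
    with onlyTwo _ facetK ρ⊆K
  ... | inj₁ K≡F₁ = F₂ , facet₂ , ρ⊆F₂ , λ F₂≡K → F₁≢F₂ (trans (sym K≡F₁) (sym F₂≡K))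
  ... | inj₂ K≡F₂ = F₁ , facet₁ , ρ⊆F₁ , λ F₁≡K → F₁≢F₂ (trans F₁≡K K≡F₂)

  oneOfTwoFacets : ∀ {ρ F₀ F₁ G} → InExactlyTwoFacets Δ ρ → F₀ ≢ F₁
                 → IsFacet Δ F₀ → IsFacet Δ F₁ → IsFacet Δ G → ρ ⊆ F₀ → ρ ⊆ F₁ → ρ ⊆ G
                 → G ≡ F₀ ⊎ G ≡ F₁
  oneOfTwoFacets (E₁ , E₂ , _ , _ , _ , _ , _ , onlyTwo) F₀≢F₁ facet₀ facet₁ facetG ρ⊆F₀ ρ⊆F₁ ρ⊆G
    with onlyTwo _ facet₀ ρ⊆F₀ | onlyTwo _ facet₁ ρ⊆F₁ | onlyTwo _ facetG ρ⊆G
  ... | inj₁ refl | inj₁ refl | _ = ⊥-elim (F₀≢F₁ refl)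
  ... | inj₂ refl | inj₂ refl | _ = ⊥-elim (F₀≢F₁ refl)
  ... | inj₁ refl | _ | inj₁ refl = inj₁ refl
  ... | inj₂ refl | _ | inj₂ refl = inj₁ refl
  ... | inj₁ refl | inj₂ refl | inj₂ refl = inj₂ refl
  ... | inj₂ refl | inj₁ refl | inj₁ refl = inj₂ refl

  module StrongConnectivity (pure : IsPure Δ d)
    (linksConnected : ∀ τ → face Δ τ → ∣ τ ∣ + 2 ≤ d → Connected (lk Δ τ)) where

    StarConnected : ℕ → Set
    StarConnected m = ∀ τ → face Δ τ → ∣ τ ∣ + m ≡ d → ∀ {F G} → IsFacet Δ F → IsFacet Δ G
                    → τ ⊆ F → τ ⊆ G → RidgePath τ F G

    -- Codimension m + 2 reduces to codimension m + 1: pick u ∈ F ─ τ and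
    -- v ∈ G ─ τ, join them by an edge path in the connected link of τ, and
    -- pass from facet to facet around τ ∪ {x} for each vertex x on the path.
    throughLink : ∀ m → StarConnected (suc m) → StarConnected (suc (suc m))
    throughLink m starConnected′ τ fτ codim {F} {G} facetF facetG τ⊆F τ⊆G =
      let u , u∈F , u∉τ = outsideOf facetF
          v , v∈G , v∉τ = outsideOf facetG
      in along v∈G (linksConnected τ fτ ∣τ∣+2≤d u v (linkVertexOf facetF τ⊆F u∈F u∉τ)
                                                  (linkVertexOf facetG τ⊆G v∈G v∉τ))
               facetF τ⊆F u∈F u∉τ
      where
      ∣τ∣+2≤d : ∣ τ ∣ + 2 ≤ d
      ∣τ∣+2≤d = ≤-trans (+-monoʳ-≤ ∣ τ ∣ (s≤s (s≤s z≤n))) (≤-reflexive codim)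

      outsideOf : ∀ {K} → IsFacet Δ K → ∃[ u ] (u ∈ K × u ∉ τ)
      outsideOf facetK = larger⇒outside τ _ (subst (∣ τ ∣ <_) (sym (pure _ facetK)) ∣τ∣<d)
        where
        ∣τ∣<d : ∣ τ ∣ < d
        ∣τ∣<d = <-≤-trans (m<m+n ∣ τ ∣ (s≤s z≤n)) ∣τ∣+2≤d

      linkVertexOf : ∀ {K u} → IsFacet Δ K → τ ⊆ K → u ∈ K → u ∉ τ → V (lk Δ τ) u
      linkVertexOf facetK τ⊆K u∈K u∉τ =
        linkVertex⇒V (outside⇒linkVertex (proj₁ facetK) τ⊆K (x∈p∧x∉q⇒x∈p─q u∈K u∉τ))

      aroundVertex : ∀ {u K K′} → u ∉ τ → IsFacet Δ K → IsFacet Δ K′ → τ ⊆ K → τ ⊆ K′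
                   → u ∈ K → u ∈ K′ → RidgePath τ K K′
      aroundVertex {u} {K} u∉τ facetK facetK′ τ⊆K τ⊆K′ u∈K u∈K′ =
        shrink (p⊆p∪q ⁅ u ⁆)
          (starConnected′ (τ ∪ ⁅ u ⁆) (dc (proj₁ facetK) τu⊆K) codim′ facetK facetK′ τu⊆K
                          (∪-lub τ⊆K′ (⁅⁆⊆ u∈K′)))
        where
        τu⊆K : τ ∪ ⁅ u ⁆ ⊆ K
        τu⊆K = ∪-lub τ⊆K (⁅⁆⊆ u∈K)
        codim′ : ∣ τ ∪ ⁅ u ⁆ ∣ + suc m ≡ d
        codim′ = trans (cong (_+ suc m) (∣∪⁅⁆∣ τ u∉τ)) (trans (sym (+-suc ∣ τ ∣ (suc m))) codim)

      along : ∀ {u v} → v ∈ G → Path (lk Δ τ) u v → ∀ {K} → IsFacet Δ K → τ ⊆ K → u ∈ K → u ∉ τ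
            → RidgePath τ K G
      along v∈G here facetK τ⊆K u∈K u∉τ = aroundVertex u∉τ facetK facetG τ⊆K τ⊆G u∈K v∈G
      along {u} v∈G (step {w = w} edge rest) facetK τ⊆K u∈K u∉τ =
        aroundVertex u∉τ facetK facetK′ τ⊆K τ⊆K′ u∈K (uw⊆K′ (p⊆p∪q ⁅ w ⁆ (x∈⁅x⁆ u)))
          ++ along v∈G rest facetK′ τ⊆K′ (uw⊆K′ w∈uw) (proj₁ (lk⇒ edge) w∈uw)
        where
        enlarged : ∃[ K′ ] (IsFacet Δ K′ × τ ∪ (⁅ u ⁆ ∪ ⁅ w ⁆) ⊆ K′)
        enlarged = extendToFacet _ (proj₂ (lk⇒ edge))
        K′ : Subset n
        K′ = proj₁ enlarged
        facetK′ : IsFacet Δ K′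
        facetK′ = proj₁ (proj₂ enlarged)
        τ⊆K′ : τ ⊆ K′
        τ⊆K′ x∈τ = proj₂ (proj₂ enlarged) (p⊆p∪q _ x∈τ)
        uw⊆K′ : ⁅ u ⁆ ∪ ⁅ w ⁆ ⊆ K′
        uw⊆K′ x∈uw = proj₂ (proj₂ enlarged) (q⊆p∪q τ _ x∈uw)
        w∈uw : w ∈ ⁅ u ⁆ ∪ ⁅ w ⁆
        w∈uw = q⊆p∪q ⁅ u ⁆ ⁅ w ⁆ (x∈⁅x⁆ w)

    -- In codimension 0, τ is the only facet containing it; in codimension 1,
    -- τ is itself a ridge shared by the two facets.
    starConnected : ∀ m → StarConnected m
    starConnected zero τ fτ ∣τ∣≡d {F} {G} facetF facetG τ⊆F τ⊆G =
      subst (RidgePath τ F) (trans (sym (τ≡facet facetF τ⊆F)) (τ≡facet facetG τ⊆G)) stay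
      where
      τ≡facet : ∀ {K} → IsFacet Δ K → τ ⊆ K → τ ≡ K
      τ≡facet facetK τ⊆K =
        ⊆-∣∣-≡ τ _ τ⊆K (≤-reflexive (trans (pure _ facetK) (sym (trans (sym (+-identityʳ ∣ τ ∣)) ∣τ∣≡d))))
    starConnected (suc zero) τ fτ ridge facetF facetG τ⊆F τ⊆G = cross τ ⊆-refl ridge τ⊆F τ⊆G facetG stay
    starConnected (suc (suc m)) = throughLink m (starConnected (suc m))

-- Propagating faces along ridge paths

module Shift {n} (Δ : Complex n) (flag : IsFlag Δ) (d : ℕ)
  (dimBound : ∀ F → face Δ F → ∣ F ∣ ≤ d) (pure : IsPure Δ d)
  (ridgesThin : ∀ ρ → face Δ ρ → ∣ ρ ∣ + 1 ≡ d → InExactlyTwoFacets Δ ρ)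
  {τ₁ τ₂ : Subset n} (f₁ : face Δ τ₁) (f₂ : face Δ τ₂) (size : ∣ τ₁ ∣ + ∣ τ₂ ∣ ≡ d)
  (σFacet : IsFacet Δ (τ₁ ∪ τ₂)) (covered : Faces.Covered Δ τ₁ τ₂)
  {H : Subset n} (facetH : IsFacet Δ H) (τ₁⊆H : τ₁ ⊆ H) where
  open Faces Δ
  open Flag Δ flag
  open Ridges Δ d

  A : Subset n
  A = H ─ τ₁

  Φ : Subset n → Subset n
  Φ G = A ∪ (G ─ τ₂)

  -- A consists of link vertices of τ₁, and these avoid the link vertices of
  -- τ₂ that G ─ τ₂ consists of.
  A-link : ∀ {x} → x ∈ A → LinkVertex τ₁ x
  A-link = outside⇒linkVertex (proj₁ facetH) τ₁⊆H

  A#rest : ∀ {G} → face Δ G → τ₂ ⊆ G → Disjoint A (G ─ τ₂)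
  A#rest fG τ₂⊆G x∈A x∈G─τ₂ =
    linkVertices-disjoint σFacet (A-link x∈A , outside⇒linkVertex fG τ₂⊆G x∈G─τ₂)

  facetRest : ∀ {τ F} → IsFacet Δ F → τ ⊆ F → ∣ τ ∣ + ∣ F ─ τ ∣ ≡ d
  facetRest {τ} {F} facetF τ⊆F = trans (∣split∣ τ F τ⊆F) (pure F facetF)

  ∣A∣ : ∣ A ∣ ≡ ∣ τ₂ ∣
  ∣A∣ = +-cancelˡ-≡ ∣ τ₁ ∣ _ _ (trans (facetRest facetH τ₁⊆H) (sym size))

  -- Φ replaces τ₂ by the equally large A, so it preserves cardinality.
  ∣Φ∣ : ∀ {G} → face Δ G → τ₂ ⊆ G → ∣ Φ G ∣ ≡ ∣ G ∣
  ∣Φ∣ {G} fG τ₂⊆G = begin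
    ∣ A ∪ (G ─ τ₂) ∣       ≡⟨ ∣∪∣ A (G ─ τ₂) (A#rest fG τ₂⊆G) ⟩
    ∣ A ∣ + ∣ G ─ τ₂ ∣     ≡⟨ cong (_+ ∣ G ─ τ₂ ∣) ∣A∣ ⟩
    ∣ τ₂ ∣ + ∣ G ─ τ₂ ∣    ≡⟨ ∣split∣ τ₂ G τ₂⊆G ⟩
    ∣ G ∣                  ∎
    where open ≡-Reasoning

  Φ-mono : ∀ {G G′} → G ⊆ G′ → Φ G ⊆ Φ G′
  Φ-mono G⊆G′ = ∪-lub (p⊆p∪q _) (λ x∈G─τ₂ → q⊆p∪q A _ (─-mono τ₂ G⊆G′ x∈G─τ₂))

  -- Every facet containing A is Φ M for a facet M ⊇ τ₂: split it into its
  -- link parts α ⊇ A and β; counting forces α = A, and M = τ₂ ∪ β.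
  Φ-shape : ∀ {L} → IsFacet Δ L → A ⊆ L → ∃[ M ] (IsFacet Δ M × τ₂ ⊆ M × L ≡ Φ M)
  Φ-shape {L} facetL A⊆L = M , facetM , p⊆p∪q β , L≡ΦM
    where
    α β : Subset n
    α = linkPart τ₁ L
    β = linkPart τ₂ L
    β#τ₂ : Disjoint β τ₂
    β#τ₂ = proj₁ (lk⇒ (linkPart∈lk f₂ (proj₁ facetL)))
    α#β : Disjoint α β
    α#β x∈α x∈β = linkVertices-disjoint σFacet (linkPart-vertex x∈α , linkPart-vertex x∈β)
    -- τ₁ ⊔ α is a face, so ∣ τ₁ ∣ + ∣ α ∣ ≤ d.
    ∣α∣≤∣τ₂∣ : ∣ α ∣ ≤ ∣ τ₂ ∣
    ∣α∣≤∣τ₂∣ with lk⇒ (linkPart∈lk f₁ (proj₁ facetL))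
    ... | α#τ₁ , fτ₁α = +-cancelˡ-≤ ∣ τ₁ ∣ _ _
          (≤-trans (≤-reflexive (sym (∣∪∣ τ₁ α (λ x∈τ₁ x∈α → α#τ₁ x∈α x∈τ₁))))
                   (≤-trans (dimBound _ fτ₁α) (≤-reflexive (sym size))))
    A≡α : A ≡ α
    A≡α = ⊆-∣∣-≡ A α (λ x∈A → linkPart-∈ (A⊆L x∈A) (A-link x∈A)) (≤-trans ∣α∣≤∣τ₂∣ (≤-reflexive (sym ∣A∣)))
    M : Subset n
    M = τ₂ ∪ β
    L≡α∪β : L ≡ α ∪ β
    L≡α∪β = face≡linkParts covered (proj₁ facetL)
    ∣M∣ : ∣ M ∣ ≡ d
    ∣M∣ = begin
      ∣ τ₂ ∪ β ∣      ≡⟨ ∣∪∣ τ₂ β (λ x∈τ₂ x∈β → β#τ₂ x∈β x∈τ₂) ⟩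
      ∣ τ₂ ∣ + ∣ β ∣  ≡⟨ cong (_+ ∣ β ∣) (trans (sym ∣A∣) (cong ∣_∣ A≡α)) ⟩
      ∣ α ∣ + ∣ β ∣   ≡⟨ sym (∣∪∣ α β α#β) ⟩
      ∣ α ∪ β ∣       ≡⟨ cong ∣_∣ (sym L≡α∪β) ⟩
      ∣ L ∣           ≡⟨ pure L facetL ⟩
      d               ∎
      where open ≡-Reasoning
    facetM : IsFacet Δ M
    facetM = fullSize⇒facet dimBound (proj₂ (lk⇒ (linkPart∈lk f₂ (proj₁ facetL)))) ∣M∣
    L≡ΦM : L ≡ Φ M
    L≡ΦM = trans L≡α∪β (cong₂ _∪_ (sym A≡α) (sym (∪─-cancel τ₂ β β#τ₂)))

  -- On faces containing τ₂, Φ reflects inclusion: a vertex of ρ outside τ₂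
  -- is a link vertex of τ₂, hence not in A, so it must come from M ─ τ₂.
  Φ-reflects : ∀ {ρ M} → face Δ ρ → τ₂ ⊆ ρ → τ₂ ⊆ M → Φ ρ ⊆ Φ M → ρ ⊆ M
  Φ-reflects {ρ} {M} fρ τ₂⊆ρ τ₂⊆M Φρ⊆ΦM {x} x∈ρ with x ∈? τ₂
  ... | yes x∈τ₂ = τ₂⊆M x∈τ₂
  ... | no x∉τ₂ with x∈p∪q⁻ A (M ─ τ₂) (Φρ⊆ΦM (q⊆p∪q A _ x∈ρ─τ₂))
    where
    x∈ρ─τ₂ : x ∈ ρ ─ τ₂
    x∈ρ─τ₂ = x∈p∧x∉q⇒x∈p─q x∈ρ x∉τ₂
  ...   | inj₁ x∈A = ⊥-elim (A#rest fρ τ₂⊆ρ x∈A (x∈p∧x∉q⇒x∈p─q x∈ρ x∉τ₂))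
  ...   | inj₂ x∈M─τ₂ = p─q⊆p M τ₂ x∈M─τ₂

  -- If Φ G₀ is a face and ρ ⊇ τ₂ is a ridge of G₀, then Φ ρ is a ridge of
  -- the facet Φ G₀; its other facet has the form Φ M, where M ⊇ ρ is a
  -- facet different from G₀.
  Φ-partner : ∀ {ρ G₀} → IsFacet Δ G₀ → τ₂ ⊆ ρ → ∣ ρ ∣ + 1 ≡ d → ρ ⊆ G₀ → face Δ (Φ G₀)
            → ∃[ M ] (IsFacet Δ M × ρ ⊆ M × G₀ ≢ M × face Δ (Φ M))
  Φ-partner {ρ} {G₀} facetG₀ τ₂⊆ρ ridge ρ⊆G₀ fΦG₀
    with otherFacet (ridgesThin (Φ ρ) (dc fΦG₀ (Φ-mono ρ⊆G₀)) Φρ-ridge) facetΦG₀ (Φ-mono ρ⊆G₀)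
    where
    Φρ-ridge : ∣ Φ ρ ∣ + 1 ≡ d
    Φρ-ridge = trans (cong (_+ 1) (∣Φ∣ (dc (proj₁ facetG₀) ρ⊆G₀) τ₂⊆ρ)) ridge
    facetΦG₀ : IsFacet Δ (Φ G₀)
    facetΦG₀ = fullSize⇒facet dimBound fΦG₀
                 (trans (∣Φ∣ (proj₁ facetG₀) (⊆-trans τ₂⊆ρ ρ⊆G₀)) (pure G₀ facetG₀))
  ... | L , facetL , Φρ⊆L , L≢ΦG₀ with Φ-shape facetL (λ x∈A → Φρ⊆L (p⊆p∪q _ x∈A))
  ...   | M , facetM , τ₂⊆M , L≡ΦM =
    M , facetM , Φ-reflects (dc (proj₁ facetG₀) ρ⊆G₀) τ₂⊆ρ τ₂⊆M (subst (Φ ρ ⊆_) L≡ΦM Φρ⊆L)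
      , (λ G₀≡M → L≢ΦG₀ (trans L≡ΦM (cong Φ (sym G₀≡M))))
      , subst (face Δ) L≡ΦM (proj₁ facetL)

  -- Crossing a ridge ρ ⊇ τ₂ from G₀ to G₁ preserves "Φ G is a face": G₁ is
  -- either G₀ or the partner M, as ρ lies in only two facets.
  Φ-step : ∀ {ρ G₀ G₁} → IsFacet Δ G₀ → IsFacet Δ G₁ → τ₂ ⊆ ρ → ∣ ρ ∣ + 1 ≡ d
         → ρ ⊆ G₀ → ρ ⊆ G₁ → face Δ (Φ G₀) → face Δ (Φ G₁)
  Φ-step {ρ} {G₀} {G₁} facetG₀ facetG₁ τ₂⊆ρ ridge ρ⊆G₀ ρ⊆G₁ fΦG₀ =
    crossTo (Φ-partner facetG₀ τ₂⊆ρ ridge ρ⊆G₀ fΦG₀)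
    where
    crossTo : ∃[ M ] (IsFacet Δ M × ρ ⊆ M × G₀ ≢ M × face Δ (Φ M)) → face Δ (Φ G₁)
    crossTo (M , facetM , ρ⊆M , G₀≢M , fΦM) =
      [ (λ G₁≡G₀ → subst (λ G → face Δ (Φ G)) (sym G₁≡G₀) fΦG₀)
      , (λ G₁≡M → subst (λ G → face Δ (Φ G)) (sym G₁≡M) fΦM) ]
      (oneOfTwoFacets (ridgesThin ρ (dc (proj₁ facetG₀) ρ⊆G₀) ridge) G₀≢M
                      facetG₀ facetM facetG₁ ρ⊆G₀ ρ⊆M ρ⊆G₁)

  Φ-along : ∀ {G₀ G} → RidgePath τ₂ G₀ G → IsFacet Δ G₀ → face Δ (Φ G₀) → face Δ (Φ G)
  Φ-along stay _ fΦG₀ = fΦG₀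
  Φ-along (cross ρ τ₂⊆ρ ridge ρ⊆G₀ ρ⊆G₁ facetG₁ rest) facetG₀ fΦG₀ =
    Φ-along rest facetG₁ (Φ-step facetG₀ facetG₁ τ₂⊆ρ ridge ρ⊆G₀ ρ⊆G₁ fΦG₀)

  Φσ : face Δ (Φ (τ₁ ∪ τ₂))
  Φσ = dc (proj₁ facetH) (∪-lub (p─q⊆p H τ₁) (λ x∈σ─τ₂ → τ₁⊆H (σ─τ₂⊆τ₁ x∈σ─τ₂)))
    where
    σ─τ₂⊆τ₁ : (τ₁ ∪ τ₂) ─ τ₂ ⊆ τ₁
    σ─τ₂⊆τ₁ x∈σ─τ₂ with x∈p∪q⁻ τ₁ τ₂ (p─q⊆p _ τ₂ x∈σ─τ₂)
    ... | inj₁ x∈τ₁ = x∈τ₁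
    ... | inj₂ x∈τ₂ = ⊥-elim (∈─-∉ _ τ₂ x∈σ─τ₂ x∈τ₂)

-- In a flag normal pseudomanifold whose links cover the vertices,
-- lk τ₁ * lk τ₂ ⊆ Δ: for α ∈ lk τ₁ and β ∈ lk τ₂ take facets H ⊇ τ₁ ∪ α and
-- G ⊇ τ₂ ∪ β; a ridge path from σ to G around τ₂ carries the face Φ σ to
-- Φ G ⊇ α ∪ β.
joinInFace : ∀ {n} (Δ : Complex n) → IsFlag Δ → ∀ {d} → (∀ F → face Δ F → ∣ F ∣ ≤ d) → IsPure Δ d
           → (∀ ρ → face Δ ρ → ∣ ρ ∣ + 1 ≡ d → InExactlyTwoFacets Δ ρ)
           → (∀ τ → face Δ τ → ∣ τ ∣ + 2 ≤ d → Connected (lk Δ τ))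
           → ∀ {τ₁ τ₂} → face Δ τ₁ → face Δ τ₂ → ∣ τ₁ ∣ + ∣ τ₂ ∣ ≡ d → IsFacet Δ (τ₁ ∪ τ₂)
           → Faces.Covered Δ τ₁ τ₂ → (lk Δ τ₁ ✶ lk Δ τ₂) ⊑ face Δ
joinInFace Δ flag {d} dimBound pure ridgesThin linksConnected {τ₁} {τ₂} f₁ f₂ size σFacet covered
           _ (α , β , lkα , lkβ , refl) =
  spanned (extendToFacet _ (proj₂ (lk⇒ lkα))) (extendToFacet _ (proj₂ (lk⇒ lkβ)))
  where
  open Faces Δ
  open Ridges Δ d
  open StrongConnectivity pure linksConnected

  spanned : ∃[ H ] (IsFacet Δ H × τ₁ ∪ α ⊆ H) → ∃[ G ] (IsFacet Δ G × τ₂ ∪ β ⊆ G) → face Δ (α ∪ β)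
  spanned (H , facetH , τ₁α⊆H) (G , facetG , τ₂β⊆G) = dc (Φ-along path σFacet Φσ) α∪β⊆ΦG
    where
    open Shift Δ flag d dimBound pure ridgesThin f₁ f₂ size σFacet covered facetH
               (λ x∈τ₁ → τ₁α⊆H (p⊆p∪q α x∈τ₁))

    path : RidgePath τ₂ (τ₁ ∪ τ₂) G
    path = starConnected ∣ τ₁ ∣ τ₂ f₂ (trans (+-comm ∣ τ₂ ∣ ∣ τ₁ ∣) size) σFacet facetG
                         (q⊆p∪q τ₁ τ₂) (λ x∈τ₂ → τ₂β⊆G (p⊆p∪q β x∈τ₂))

    α∪β⊆ΦG : α ∪ β ⊆ Φ G
    α∪β⊆ΦG = ∪-lub (λ x∈α → p⊆p∪q _ (linkFace-⊆-─ lkα τ₁α⊆H x∈α))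
                   (λ x∈β → q⊆p∪q A _ (linkFace-⊆-─ lkβ τ₂β⊆G x∈β))

-- Lemma 5.6.
lemma5p6 : ∀ {n} (Δ : Complex n) (d : ℕ) → IsFlag Δ → HasDim Δ d
    → (τ₁ τ₂ : Subset n) → face Δ τ₁ → face Δ τ₂ → Empty (τ₁ ∩ τ₂)
    → ∣ τ₁ ∣ + ∣ τ₂ ∣ ≡ d → IsFacet Δ (τ₁ ∪ τ₂)
    → (VertexUnionIs (lk Δ τ₁) (lk Δ τ₂) (face Δ) → face Δ ⊑ (lk Δ τ₁ ✶ lk Δ τ₂))
      × (IsNormalPseudomanifold Δ d
          → (VertexUnionIs (lk Δ τ₁) (lk Δ τ₂) (face Δ) → face Δ ≐ (lk Δ τ₁ ✶ lk Δ τ₂))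
            × (face Δ ≐ (lk Δ τ₁ ✶ lk Δ τ₂) → VertexUnionIs (lk Δ τ₁) (lk Δ τ₂) (face Δ)))
lemma5p6 Δ d flag (_ , dimBound) τ₁ τ₂ f₁ f₂ _ size σFacet = inclusion , pseudomanifold
  where
  open Faces Δ
  open Flag Δ flag

  inclusion : VertexUnionIs (lk Δ τ₁) (lk Δ τ₂) (face Δ) → face Δ ⊑ (lk Δ τ₁ ✶ lk Δ τ₂)
  inclusion vertexUnion = faceInJoin f₁ f₂ (vertexUnion⇒covered vertexUnion)

  pseudomanifold : IsNormalPseudomanifold Δ d
    → (VertexUnionIs (lk Δ τ₁) (lk Δ τ₂) (face Δ) → face Δ ≐ (lk Δ τ₁ ✶ lk Δ τ₂))
      × (face Δ ≐ (lk Δ τ₁ ✶ lk Δ τ₂) → VertexUnionIs (lk Δ τ₁) (lk Δ τ₂) (face Δ))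
  pseudomanifold ((_ , pure , ridgesThin) , _ , linksConnected) =
    (λ vertexUnion → inclusion vertexUnion
                   , joinInFace Δ flag dimBound pure ridgesThin linksConnected f₁ f₂ size σFacet
                                (vertexUnion⇒covered vertexUnion))
    , λ Δ≐join → joinCovers (proj₁ Δ≐join)
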